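{- Let $F$ be a forest on the vertex set $\mathcal N=\{1,\dots,N\}$ and $\mathcal D\subseteq\mathcal N$. (i) If $F$ has no arc with origin outside $\mathcal D$ and terminus in $\mathcal D$, then for every forest $G$ on $\mathcal N$ the $\mathcal D$-exchange of $F$ by $G$ is a forest. (ii) If $F$ has no arc with origin in $\mathcal D$ and terminus outside $\mathcal D$, then for every forest $G$ on $\mathcal N$ the $\mathcal D$-exchange of $G$ by $F$ is a forest.
   Context: A forest is a digraph without directed circuits (loops count as circuits) in which every vertex has outdegree $0$ or $1$. For digraphs $F,G$ on $\mathcal N$ and $\mathcal D\subseteq\mathcal N$, the $\mathcal D$-exchange of $F$ by $G$ is the digraph on $\mathcal N$ whose arcs are the arcs of $F$ with origin outside $\mathcal D$ together with the arcs of $G$ with origin in $\mathcal D$. -}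

module Defs where

open import Data.Nat using (ℕ)
open import Data.Fin using (Fin)
open import Data.Fin.Subset using (Subset; _∈_; _∉_)
open import Data.Fin.Subset.Properties using (_∈?_)
open import Data.Bool using (Bool; T; true; false; if_then_else_)
open import Data.Product using (_×_; ∃)
open import Relation.Nullary using (¬_)
open import Relation.Nullary.Decidable using (does)
open import Relation.Binary.PropositionalEquality using (_≡_)
open import Relation.Binary.Construct.Closure.Transitive using (TransClosure)

-- A (simple) digraph on the vertex set 𝒩 = Fin N, given by its arc set:
-- (u , v) is an arc (origin u, terminus v) iff  arc u v ≡ true.
-- Vertex i of Fin N stands for vertex i+1 of {1,…,N}.
Digraph : ℕ → Set
Digraph N = Fin N → Fin N → Bool

Arc : ∀ {N} → Digraph N → Fin N → Fin N → Set
Arc F u v = T (F u v)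

-- F has a directed circuit (loops count): some vertex reaches itself by a
-- nonempty directed walk.  (A nonempty closed walk exists iff a directed
-- circuit exists.)
HasCircuit : ∀ {N} → Digraph N → Set
HasCircuit F = ∃ λ v → TransClosure (Arc F) v v

OutdegAtMostOne : ∀ {N} → Digraph N → Set
OutdegAtMostOne F = ∀ u v w → Arc F u v → Arc F u w → v ≡ w

IsForest : ∀ {N} → Digraph N → Set
IsForest F = ¬ HasCircuit F × OutdegAtMostOne F

exchange : ∀ {N} → Subset N → Digraph N → Digraph N → Digraph N
exchange D F G u v = if does (u ∈? D) then G u v else F u v

-- A closed walk in the exchanged digraph either meets the part of the vertex set
-- that the retained digraph cannot leave, and then it never leaves it and is a
-- circuit of that digraph, or it avoids that part and is a circuit of the other
-- digraph. Outdegrees are inherited vertexwise from one of the two forests.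
module Submission where

open import Defs
open import Data.Nat using (ℕ)
open import Data.Fin.Subset using (Subset; _∈_; _∉_)
open import Data.Fin.Subset.Properties using (_∈?_)
open import Data.Product using (_×_; ∃; _,_)
open import Relation.Nullary using (¬_; yes; no; contradiction)
open import Relation.Nullary.Decidable using (¬?; decidable-stable)
open import Relation.Unary using (Pred; Decidable)
open import Relation.Binary.Core using (Rel)
open import Relation.Binary.Construct.Closure.Transitive using (TransClosure; [_]; _∷_)

module Splice {a p ℓ} {A : Set a} {P : Pred A p} (P? : Decidable P)
  {F G H : Rel A ℓ}
  (F-closed : ∀ {u v} → P u → F u v → P v)
  (H⇒F : ∀ {u v} → P u → H u v → F u v)
  (H⇒G : ∀ {u v} → ¬ P u → H u v → G u v) where

  F-walk-stays : ∀ {u w} → P u → TransClosure F u w → P w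
  F-walk-stays pu [ e ] = F-closed pu e
  F-walk-stays pu (e ∷ walk) = F-walk-stays (F-closed pu e) walk

  H-walk-from-P : ∀ {u w} → P u → TransClosure H u w → TransClosure F u w
  H-walk-from-P pu [ e ] = [ H⇒F pu e ]
  H-walk-from-P pu (e ∷ walk) = H⇒F pu e ∷ H-walk-from-P (F-closed pu (H⇒F pu e)) walk

  H-walk-outside-P : ∀ {u w} → ¬ P u → ¬ P w → TransClosure H u w → TransClosure G u w
  H-walk-outside-P ¬pu ¬pw [ e ] = [ H⇒G ¬pu e ]
  H-walk-outside-P ¬pu ¬pw (_∷_ {y = x} e walk) with P? x
  ... | yes px = contradiction (F-walk-stays px (H-walk-from-P px walk)) ¬pw
  ... | no ¬px = H⇒G ¬pu e ∷ H-walk-outside-P ¬px ¬pw walk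

  acyclic : ¬ (∃ λ v → TransClosure F v v) → ¬ (∃ λ v → TransClosure G v v) →
            ¬ (∃ λ v → TransClosure H v v)
  acyclic noF noG (v , circuit) with P? v
  ... | yes pv = noF (v , H-walk-from-P pv circuit)
  ... | no ¬pv = noG (v , H-walk-outside-P ¬pv ¬pv circuit)

module _ {N : ℕ} (D : Subset N) (F G : Digraph N) where

  exchange-∉ : ∀ {u v} → u ∉ D → Arc (exchange D F G) u v → Arc F u v
  exchange-∉ {u} u∉D e with u ∈? D
  ... | yes u∈D = contradiction u∈D u∉D
  ... | no _ = e

  exchange-∈ : ∀ {u v} → u ∈ D → Arc (exchange D F G) u v → Arc G u v
  exchange-∈ {u} u∈D e with u ∈? D
  ... | yes _ = e
  ... | no u∉D = contradiction u∈D u∉D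

  exchange-outdeg : OutdegAtMostOne F → OutdegAtMostOne G → OutdegAtMostOne (exchange D F G)
  exchange-outdeg outF outG u with u ∈? D
  ... | yes _ = outG u
  ... | no _ = outF u

mainTheorem15 : ∀ (N : ℕ) (F : Digraph N) (D : Subset N) → IsForest F →
    ((¬ (∃ λ u → ∃ λ v → u ∉ D × v ∈ D × Arc F u v)) →
    ∀ (G : Digraph N) → IsForest G → IsForest (exchange D F G))
    × ((¬ (∃ λ u → ∃ λ v → u ∈ D × v ∉ D × Arc F u v)) →
    ∀ (G : Digraph N) → IsForest G → IsForest (exchange D G F))
mainTheorem15 N F D (noCircuitF , outF) = keepOutside , keepInside
  where
  keepOutside : ¬ (∃ λ u → ∃ λ v → u ∉ D × v ∈ D × Arc F u v) →
                ∀ G → IsForest G → IsForest (exchange D F G)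
  keepOutside noArcIn G (noCircuitG , outG) =
    Splice.acyclic (λ u → ¬? (u ∈? D)) outsideClosed
      (exchange-∉ D F G) (λ ¬u∉D → exchange-∈ D F G (decidable-stable (_ ∈? D) ¬u∉D))
      noCircuitF noCircuitG
    , exchange-outdeg D F G outF outG
    where
    outsideClosed : ∀ {u v} → u ∉ D → Arc F u v → v ∉ D
    outsideClosed u∉D e v∈D = noArcIn (_ , _ , u∉D , v∈D , e)

  keepInside : ¬ (∃ λ u → ∃ λ v → u ∈ D × v ∉ D × Arc F u v) →
               ∀ G → IsForest G → IsForest (exchange D G F)
  keepInside noArcOut G (noCircuitG , outG) =
    Splice.acyclic (_∈? D) insideClosed (exchange-∈ D G F) (exchange-∉ D G F)
      noCircuitF noCircuitG
    , exchange-outdeg D G F outG outF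
    where
    insideClosed : ∀ {u v} → u ∈ D → Arc F u v → v ∈ D
    insideClosed {v = v} u∈D e =
      decidable-stable (v ∈? D) (λ v∉D → noArcOut (_ , _ , u∈D , v∉D , e))
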